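{- Let $d$ be a positive integer and $n,h$ integers with $0\leq h\leq n$. If $n-h<d$ and $2(n-h)<n$, then $C_{n,h}^{(d)}=P(n-h)$, where $P(m)$ denotes the number of partitions of $m$.
   Context: $\Lambda_d=\mathbb{Z}_{\geq0}^d$ with basis $\mathbf{e}(1),\dots,\mathbf{e}(d)$; $\Lambda_d^{(h)}$ is the set of elements with coordinate sum $h$. $X_d=\{\mathbf{e}(k)-\mathbf{e}(i)-\mathbf{e}(j): i,j,k\in\{1,\dots,d\},\ d\mid k-i-j\}$; for $\mathbf{v},\mathbf{w}\in\Lambda_d$, $\mathbf{v}\lessdot\mathbf{w}$ iff $\mathbf{v}-\mathbf{w}\in X_d$; $\prec$ is the transitive closure of $\lessdot$ on $\Lambda_d$; $I(\mathbf v)=\{\mathbf v\}\cup\{\mathbf w\in\Lambda_d:\mathbf w\prec\mathbf v\}$; $C_{n,h}^{(d)}=|I(n\mathbf{e}(1))\cap\Lambda_d^{(h)}|$. -}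

module Defs where

open import Data.Nat as ℕ using (ℕ; zero; suc)
open import Data.Integer as ℤ using (ℤ; +_)
open import Data.Integer.Divisibility using (_∣_)
open import Data.Fin using (Fin; toℕ; _≟_)
open import Data.Vec using (Vec; tabulate; map; zipWith; sum; lookup)
open import Data.List using (List; [])
import Data.Nat.ListAction as LA
open import Data.List.Relation.Unary.All using (All)
open import Data.List.Relation.Unary.Linked using (Linked)
open import Data.Product using (Σ; ∃; _×_; proj₁; _,_)
open import Data.Sum using (_⊎_)
open import Relation.Nullary.Decidable using (does)
open import Data.Bool using (if_then_else_)
open import Relation.Binary.PropositionalEquality using (_≡_)
open import Relation.Binary.Construct.Closure.Transitive using (TransClosure)
open import Relation.Binary.Bundles using (Setoid)
import Relation.Binary.PropositionalEquality as PE
import Relation.Binary.Construct.On as On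

-- Λ_d = ℤ_{≥0}^d, represented as length-d vectors of naturals.
-- Index a : Fin d stands for the coordinate a+1 ∈ {1,…,d}.
Λ : ℕ → Set
Λ d = Vec ℕ d

e : {d : ℕ} → Fin d → Vec ℕ d
e a = tabulate (λ l → if does (a ≟ l) then 1 else 0)

eℤ : {d : ℕ} → Fin d → Vec ℤ d
eℤ a = map +_ (e a)

-- coordinate sum; Λ_d^{(h)} = { v | coordSum v ≡ h }
coordSum : {d : ℕ} → Vec ℕ d → ℕ
coordSum = sum

lbl : {d : ℕ} → Fin d → ℤ
lbl a = + suc (toℕ a)

xvec : {d : ℕ} → Fin d → Fin d → Fin d → Vec ℤ d
xvec i j k = zipWith ℤ._-_ (zipWith ℤ._-_ (eℤ k) (eℤ i)) (eℤ j)

_⋖_ : {d : ℕ} → Vec ℕ d → Vec ℕ d → Set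
_⋖_ {d} v w = Σ (Fin d) λ i → Σ (Fin d) λ j → Σ (Fin d) λ k →
  ((+ d) ∣ (lbl k ℤ.- lbl i ℤ.- lbl j)) ×
  (map +_ v ≡ zipWith ℤ._+_ (map +_ w) (xvec i j k))

_≺_ : {d : ℕ} → Vec ℕ d → Vec ℕ d → Set
_≺_ = TransClosure _⋖_

_∈I_ : {d : ℕ} → Vec ℕ d → Vec ℕ d → Set
w ∈I v = (w ≡ v) ⊎ (w ≺ v)

-- the set I(n e(1)) ∩ Λ_d^{(h)} (for d = suc d', e(1) is index zero)
ISlice : (d' n h : ℕ) → Set
ISlice d' n h = Σ (Vec ℕ (suc d')) λ w →
  (w ∈I map (n ℕ.*_) (e {suc d'} Data.Fin.zero)) × (coordSum w ≡ h)

ISliceSetoid : (d' n h : ℕ) → Setoid _ _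
ISliceSetoid d' n h = On.setoid {B = ISlice d' n h} (PE.setoid (Vec ℕ (suc d'))) proj₁

IsPartition : ℕ → List ℕ → Set
IsPartition m λs = All (λ x → 0 ℕ.< x) λs × Linked ℕ._≥_ λs × (LA.sum λs ≡ m)

Partition : ℕ → Set
Partition m = Σ (List ℕ) (IsPartition m)

PartitionSetoid : ℕ → Setoid _ _
PartitionSetoid m = On.setoid {B = Partition m} (PE.setoid (List ℕ)) proj₁

-- Give the coordinate labelled a the weight a.  A step v ⋖ w changes the weight
-- by k − i − j, a multiple of d that is smaller than d, hence zero or a negative
-- multiple of d, and lowers the coordinate sum by one.  So every w ∈ I(n e(1))
-- has weight n − d t.  On the slice of coordinate sum h that weight is
-- h + Σ_{a ≥ 2} (a − 1) w_a, and n − h < d forces t = 0.  Conversely, if w_{a+1} > 0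
-- then w ⋖ w − e(a+1) + e(a) + e(1), a step that keeps the weight and lowers
-- Σ_{a ≥ 2} (a − 1) w_a, so every vector of weight n lies in I(n e(1)).  Reading
-- w_{a+1} as the number of parts equal to a identifies the slice with the
-- partitions of n − h; the remaining coordinate w_1 = h − (number of parts) is
-- nonnegative because 2 (n − h) < n.

module Submission where

open import Data.Bool using (if_then_else_)
open import Data.Fin using (Fin; toℕ; inject₁) renaming (zero to fzero; suc to fsuc; _≟_ to _≟ᶠ_)
open import Data.Fin.Properties using (toℕ<n; toℕ-inject₁)
open import Data.Integer as ℤ using (ℤ; +_; -[1+_])
open import Data.Integer.Divisibility using () renaming (_∣_ to _∣ℤ_)
import Data.Integer.Properties as ℤ
open import Data.Integer.Tactic.RingSolver using (solve-∀)
open import Data.List using (List; []; _∷_; _++_; replicate; length; filter)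
open import Data.List.Properties using (length-++; length-replicate; filter-++; filter-all; filter-none)
open import Data.List.Relation.Unary.All using (All; []; _∷_)
import Data.List.Relation.Unary.All as All
import Data.List.Relation.Unary.All.Properties as All
open import Data.List.Relation.Unary.AllPairs using (AllPairs; []; _∷_)
import Data.List.Relation.Unary.AllPairs.Properties as AllPairs
open import Data.List.Relation.Unary.Linked.Properties using (AllPairs⇒Linked; Linked⇒AllPairs)
open import Data.Nat using (ℕ; zero; suc; _+_; _*_; _∸_; _≤_; _<_; _≥_; z≤n; s≤s; _≟_)
open import Data.Nat.Divisibility using (>⇒∤; m∣n⇒n≡m*quotient; quotient; _∣0)
open import Data.Nat.ListAction using () renaming (sum to sumᴸ)
open import Data.Nat.ListAction.Properties using (sum-++)
import Data.Nat.Properties as ℕ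
open import Data.Nat.Tactic.RingSolver using () renaming (solve-∀ to ℕ-solve-∀)
open import Data.Product using (∃; ∃₂; _×_; _,_; proj₂)
open import Data.Sum using (_⊎_; inj₁; inj₂)
open import Data.Vec using (Vec; []; _∷_; map; zipWith; tabulate; lookup; sum; tail)
open import Data.Vec.Properties using (lookup-map; lookup-zipWith; lookup∘tabulate; tabulate∘lookup; tabulate-cong)
open import Function using (_∘_)
open import Function.Bundles using (Inverse)
open import Relation.Binary.Construct.Closure.Transitive using ([_]; _∷_)
open import Relation.Binary.PropositionalEquality
open import Relation.Nullary using (contradiction; yes; no; does)

open import Defs

private
  variable
    d : ℕ

linear : (ℕ → ℤ) → ℕ → Vec ℤ d → ℤ
linear c s []       = + 0
linear c s (x ∷ xs) = c s ℤ.* x ℤ.+ linear c (suc s) xs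

weight : ℕ → Vec ℕ d → ℕ
weight s []       = 0
weight s (x ∷ xs) = s * x + weight (suc s) xs

-- A tabulation rather than a replicate, so that e zero ≡ 1 ∷ zeros d by computation.
zeros : ∀ d → Vec ℕ d
zeros d = tabulate (λ _ → 0)

linear-+ : ∀ c s (u v : Vec ℤ d) →
  linear c s (zipWith ℤ._+_ u v) ≡ linear c s u ℤ.+ linear c s v
linear-+ c s []      []      = refl
linear-+ c s (x ∷ u) (y ∷ v) rewrite linear-+ c (suc s) u v = interchange (c s) x y _ _
  where
  interchange : ∀ a x y U V → a ℤ.* (x ℤ.+ y) ℤ.+ (U ℤ.+ V) ≡ (a ℤ.* x ℤ.+ U) ℤ.+ (a ℤ.* y ℤ.+ V)
  interchange = solve-∀

linear-- : ∀ c s (u v : Vec ℤ d) →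
  linear c s (zipWith ℤ._-_ u v) ≡ linear c s u ℤ.- linear c s v
linear-- c s []      []      = refl
linear-- c s (x ∷ u) (y ∷ v) rewrite linear-- c (suc s) u v = interchange (c s) x y _ _
  where
  interchange : ∀ a x y U V → a ℤ.* (x ℤ.- y) ℤ.+ (U ℤ.- V) ≡ (a ℤ.* x ℤ.+ U) ℤ.- (a ℤ.* y ℤ.+ V)
  interchange = solve-∀

linear-zeros : ∀ c s → linear c s (map +_ (zeros d)) ≡ + 0
linear-zeros {zero}  c s = refl
linear-zeros {suc d} c s rewrite linear-zeros {d} c (suc s) | ℤ.*-zeroʳ (c s) = refl

linear-eℤ : ∀ c s (a : Fin d) → linear c s (eℤ a) ≡ c (s + toℕ a)
linear-eℤ {suc d} c s fzero
  rewrite linear-zeros {d} c (suc s) | ℤ.*-identityʳ (c s) | ℕ.+-identityʳ s = ℤ.+-identityʳ (c s)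
linear-eℤ {suc d} c s (fsuc a)
  rewrite ℤ.*-zeroʳ (c s) | ℕ.+-suc s (toℕ a) = trans (ℤ.+-identityˡ _) (linear-eℤ c (suc s) a)

linear-weight : ∀ s (v : Vec ℕ d) → linear +_ s (map +_ v) ≡ + weight s v
linear-weight s []      = refl
linear-weight s (x ∷ v) = cong₂ ℤ._+_ (sym (ℤ.pos-* s x)) (linear-weight (suc s) v)

linear-sum : ∀ s (v : Vec ℕ d) → linear (λ _ → + 1) s (map +_ v) ≡ + sum v
linear-sum s []      = refl
linear-sum s (x ∷ v) = cong₂ ℤ._+_ (ℤ.*-identityˡ (+ x)) (linear-sum (suc s) v)

linear-xvec : ∀ c s (i j k : Fin d) →
  linear c s (xvec i j k) ≡ c (s + toℕ k) ℤ.- c (s + toℕ i) ℤ.- c (s + toℕ j)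
linear-xvec c s i j k = begin
  linear c s (xvec i j k)
    ≡⟨ linear-- c s (zipWith ℤ._-_ (eℤ k) (eℤ i)) (eℤ j) ⟩
  linear c s (zipWith ℤ._-_ (eℤ k) (eℤ i)) ℤ.- linear c s (eℤ j)
    ≡⟨ cong (ℤ._- linear c s (eℤ j)) (linear-- c s (eℤ k) (eℤ i)) ⟩
  linear c s (eℤ k) ℤ.- linear c s (eℤ i) ℤ.- linear c s (eℤ j)
    ≡⟨ cong₂ ℤ._-_ (cong₂ ℤ._-_ (linear-eℤ c s k) (linear-eℤ c s i)) (linear-eℤ c s j) ⟩
  c (s + toℕ k) ℤ.- c (s + toℕ i) ℤ.- c (s + toℕ j) ∎
  where open ≡-Reasoning

linear-step : ∀ c s {v w : Vec ℕ d} (i j k : Fin d) →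
  map +_ v ≡ zipWith ℤ._+_ (map +_ w) (xvec i j k) →
  linear c s (map +_ v) ≡ linear c s (map +_ w) ℤ.+ (c (s + toℕ k) ℤ.- c (s + toℕ i) ℤ.- c (s + toℕ j))
linear-step c s {v} {w} i j k v≡w+x = begin
  linear c s (map +_ v)                                   ≡⟨ cong (linear c s) v≡w+x ⟩
  linear c s (zipWith ℤ._+_ (map +_ w) (xvec i j k))      ≡⟨ linear-+ c s (map +_ w) (xvec i j k) ⟩
  linear c s (map +_ w) ℤ.+ linear c s (xvec i j k)       ≡⟨ cong (λ z → linear c s (map +_ w) ℤ.+ z) (linear-xvec c s i j k) ⟩
  linear c s (map +_ w) ℤ.+ (c (s + toℕ k) ℤ.- c (s + toℕ i) ℤ.- c (s + toℕ j)) ∎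
  where open ≡-Reasoning

weight-step : ∀ {v w : Vec ℕ d} (i j k : Fin d) →
  map +_ v ≡ zipWith ℤ._+_ (map +_ w) (xvec i j k) →
  + weight 1 v ≡ + weight 1 w ℤ.+ (lbl k ℤ.- lbl i ℤ.- lbl j)
weight-step {v = v} {w} i j k v≡w+x =
  trans (sym (linear-weight 1 v))
    (trans (linear-step +_ 1 i j k v≡w+x) (cong (ℤ._+ _) (linear-weight 1 w)))

sum-step : ∀ {v w : Vec ℕ d} (i j k : Fin d) →
  map +_ v ≡ zipWith ℤ._+_ (map +_ w) (xvec i j k) →
  + sum v ≡ + sum w ℤ.+ -[1+ 0 ]
sum-step {v = v} {w} i j k v≡w+x =
  trans (sym (linear-sum 0 v))
    (trans (linear-step (λ _ → + 1) 0 i j k v≡w+x) (cong (ℤ._+ _) (linear-sum 0 w)))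

infix 4 _≼[_]_

record _≼[_]_ (a d b : ℕ) : Set where
  constructor _,_
  field
    q       : ℕ
    b≡a+d*q : b ≡ a + d * q

≼-reflexive : ∀ {a b d} → a ≡ b → a ≼[ d ] b
≼-reflexive {a} {d = d} refl = 0 , sym (trans (cong (λ x → a + x) (ℕ.*-zeroʳ d)) (ℕ.+-identityʳ a))

≼-trans : ∀ {a b c d} → a ≼[ d ] b → b ≼[ d ] c → a ≼[ d ] c
≼-trans {a} {b} {c} {d} (q , b≡) (r , c≡) = q + r , (begin
  c                       ≡⟨ c≡ ⟩
  b + d * r               ≡⟨ cong (_+ d * r) b≡ ⟩
  a + d * q + d * r       ≡⟨ ℕ.+-assoc a (d * q) (d * r) ⟩
  a + (d * q + d * r)     ≡⟨ cong (λ x → a + x) (ℕ.*-distribˡ-+ d q r) ⟨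
  a + d * (q + r)         ∎)
  where open ≡-Reasoning

≼-<⇒≡ : ∀ {a b d} → a ≼[ d ] b → b < d → a ≡ b
≼-<⇒≡ {a} {d = d} (zero , b≡) b<d = sym (trans b≡ (trans (cong (λ x → a + x) (ℕ.*-zeroʳ d)) (ℕ.+-identityʳ a)))
≼-<⇒≡ {a} {d = d} (suc q , refl) b<d =
  contradiction (ℕ.≤-trans (ℕ.m≤m*n d (suc q)) (ℕ.m≤n+m (d * suc q) a)) (ℕ.<⇒≱ b<d)

+a≡+b-1+c⇒b≡a+1+c : ∀ {a b c} → + a ≡ + b ℤ.+ -[1+ c ] → b ≡ a + suc c
+a≡+b-1+c⇒b≡a+1+c {a} {b} {c} eq = ℤ.+-injective (begin
  + b                             ≡⟨ cancel (+ b) -[1+ c ] ⟩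
  + b ℤ.+ -[1+ c ] ℤ.- -[1+ c ]   ≡⟨ cong (ℤ._- -[1+ c ]) eq ⟨
  + a ℤ.- -[1+ c ]                ∎)
  where
  open ≡-Reasoning
  cancel : ∀ x y → x ≡ x ℤ.+ y ℤ.- y
  cancel = solve-∀

label-difference-< : ∀ {d c} (i j k : Fin d) → lbl k ℤ.- lbl i ℤ.- lbl j ≡ + c → c < d
label-difference-< {d} {c} i j k x≡c = begin-strict
  c                                 <⟨ ℕ.m<m+n c (s≤s z≤n) ⟩
  c + (suc (toℕ i) + suc (toℕ j))   ≡⟨ ℤ.+-injective c+i+j≡k ⟩
  suc (toℕ k)                       ≤⟨ toℕ<n k ⟩
  d                                 ∎
  where
  open ℕ.≤-Reasoning
  rearrange : ∀ x y z → x ℤ.- y ℤ.- z ℤ.+ (y ℤ.+ z) ≡ x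
  rearrange = solve-∀
  c+i+j≡k : + c ℤ.+ (lbl i ℤ.+ lbl j) ≡ lbl k
  c+i+j≡k = trans (cong (ℤ._+ (lbl i ℤ.+ lbl j)) (sym x≡c)) (rearrange (lbl k) (lbl i) (lbl j))

⋖-weight : {v w : Vec ℕ d} → v ⋖ w → weight 1 v ≼[ d ] weight 1 w
-- lbl k − lbl i − lbl j < d, so as a multiple of d it is 0 or negative.
⋖-weight {v = v} (i , j , k , d∣x , v≡w+x) with lbl k ℤ.- lbl i ℤ.- lbl j in x≡ | weight-step i j k v≡w+x
... | + zero   | v≡w = ≼-reflexive (trans (ℤ.+-injective v≡w) (ℕ.+-identityʳ _))
... | + suc c  | _   = contradiction d∣x (>⇒∤ (label-difference-< i j k x≡))
... | -[1+ c ] | v≡w = quotient d∣x , trans (+a≡+b-1+c⇒b≡a+1+c v≡w) (cong (λ x → weight 1 v + x) (m∣n⇒n≡m*quotient d∣x))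

⋖-sum : {v w : Vec ℕ d} → v ⋖ w → sum w ≡ suc (sum v)
⋖-sum {v = v} (i , j , k , _ , v≡w+x) = trans (+a≡+b-1+c⇒b≡a+1+c (sum-step i j k v≡w+x)) (ℕ.+-comm (sum v) 1)

≺⇒weight≼ : {v w : Vec ℕ d} → v ≺ w → weight 1 v ≼[ d ] weight 1 w
≺⇒weight≼ [ v⋖w ]      = ⋖-weight v⋖w
≺⇒weight≼ (v⋖u ∷ u≺w) = ≼-trans (⋖-weight v⋖u) (≺⇒weight≼ u≺w)

∈I⇒weight≼ : {v w : Vec ℕ d} → v ∈I w → weight 1 v ≼[ d ] weight 1 w
∈I⇒weight≼ (inj₁ refl) = ≼-reflexive refl
∈I⇒weight≼ (inj₂ v≺w)  = ≺⇒weight≼ v≺w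

lookup-ext : ∀ {A : Set} {u v : Vec A d} → (∀ a → lookup u a ≡ lookup v a) → u ≡ v
lookup-ext {u = u} {v} u≗v = trans (sym (tabulate∘lookup u)) (trans (tabulate-cong u≗v) (tabulate∘lookup v))

split : (i j k : Fin d) → Vec ℕ d → Vec ℕ d
split i j k w = tabulate λ a → lookup w a ∸ lookup (e k) a + lookup (e i) a + lookup (e j) a

lookup-e≤ : ∀ {w : Vec ℕ d} {k} → 1 ≤ lookup w k → ∀ a → lookup (e k) a ≤ lookup w a
lookup-e≤ {k = k} 1≤w a rewrite lookup∘tabulate (λ l → if does (k ≟ᶠ l) then 1 else 0) a with k ≟ᶠ a
... | yes refl = 1≤w
... | no _     = z≤n

split-xvec : ∀ {w : Vec ℕ d} (i j k : Fin d) → 1 ≤ lookup w k →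
  map +_ w ≡ zipWith ℤ._+_ (map +_ (split i j k w)) (xvec i j k)
split-xvec {w = w} i j k 1≤w = lookup-ext λ a → begin
  lookup (map +_ w) a
    ≡⟨ lookup-map a +_ w ⟩
  + lookup w a
    ≡⟨ cong +_ (ℕ.m∸n+n≡m (lookup-e≤ {w = w} {k} 1≤w a)) ⟨
  + (lookup w a ∸ E k a) ℤ.+ + E k a
    ≡⟨ regroup (+ (lookup w a ∸ E k a)) (+ E k a) (+ E i a) (+ E j a) ⟩
  + (lookup w a ∸ E k a + E i a + E j a) ℤ.+ (+ E k a ℤ.- + E i a ℤ.- + E j a)
    ≡⟨ cong₂ ℤ._+_ (sym (trans (lookup-map a +_ (split i j k w)) (cong +_ (lookup∘tabulate _ a))))
                   (sym (lookup-xvec a)) ⟩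
  lookup (map +_ (split i j k w)) a ℤ.+ lookup (xvec i j k) a
    ≡⟨ lookup-zipWith ℤ._+_ a (map +_ (split i j k w)) (xvec i j k) ⟨
  lookup (zipWith ℤ._+_ (map +_ (split i j k w)) (xvec i j k)) a ∎
  where
  open ≡-Reasoning
  E : Fin _ → Fin _ → ℕ
  E b a = lookup (e b) a
  regroup : ∀ x c y z → x ℤ.+ c ≡ x ℤ.+ y ℤ.+ z ℤ.+ (c ℤ.- y ℤ.- z)
  regroup = solve-∀
  lookup-eℤ : ∀ b a → lookup (eℤ b) a ≡ + E b a
  lookup-eℤ b a = lookup-map a +_ (e b)
  lookup-xvec : ∀ a → lookup (xvec i j k) a ≡ + E k a ℤ.- + E i a ℤ.- + E j a
  lookup-xvec a = begin
    lookup (xvec i j k) a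
      ≡⟨ lookup-zipWith ℤ._-_ a (zipWith ℤ._-_ (eℤ k) (eℤ i)) (eℤ j) ⟩
    lookup (zipWith ℤ._-_ (eℤ k) (eℤ i)) a ℤ.- lookup (eℤ j) a
      ≡⟨ cong (ℤ._- lookup (eℤ j) a) (lookup-zipWith ℤ._-_ a (eℤ k) (eℤ i)) ⟩
    lookup (eℤ k) a ℤ.- lookup (eℤ i) a ℤ.- lookup (eℤ j) a
      ≡⟨ cong₂ ℤ._-_ (cong₂ ℤ._-_ (lookup-eℤ k a) (lookup-eℤ i a)) (lookup-eℤ j a) ⟩
    + E k a ℤ.- + E i a ℤ.- + E j a ∎

weight-suc : ∀ s (v : Vec ℕ d) → weight (suc s) v ≡ sum v + weight s v
weight-suc s []      = refl
weight-suc s (x ∷ v) rewrite weight-suc (suc s) v = shuffle x s (sum v) (weight (suc s) v)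
  where
  shuffle : ∀ x s S W → suc s * x + (S + W) ≡ x + S + (s * x + W)
  shuffle = ℕ-solve-∀

weight-zeros : ∀ s → weight s (zeros d) ≡ 0
weight-zeros {zero}  s = refl
weight-zeros {suc d} s rewrite ℕ.*-zeroʳ s = weight-zeros {d} (suc s)

map-*-e₀ : ∀ n → map (n *_) (e {suc d} fzero) ≡ n ∷ zeros d
map-*-e₀ {d} n = cong₂ _∷_ (ℕ.*-identityʳ n) (map-*-zeros d)
  where
  map-*-zeros : ∀ d → map (n *_) (zeros d) ≡ zeros d
  map-*-zeros zero    = refl
  map-*-zeros (suc d) = cong₂ _∷_ (ℕ.*-zeroʳ n) (map-*-zeros d)

weight-∷-zeros : ∀ n → weight 1 (n ∷ zeros d) ≡ n
weight-∷-zeros {d} n rewrite weight-zeros {d} 2 = trans (ℕ.+-identityʳ (1 * n)) (ℕ.*-identityˡ n)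

nonzero-or-zeros : (v : Vec ℕ d) → (∃ λ a → 1 ≤ lookup v a) ⊎ v ≡ zeros d
nonzero-or-zeros []          = inj₂ refl
nonzero-or-zeros (suc x ∷ v) = inj₁ (fzero , s≤s z≤n)
nonzero-or-zeros (zero ∷ v) with nonzero-or-zeros v
... | inj₁ (a , 1≤v[a]) = inj₁ (fsuc a , 1≤v[a])
... | inj₂ v≡0          = inj₂ (cong (0 ∷_) v≡0)

⋖-∈I : {u v t : Vec ℕ d} → u ⋖ v → v ∈I t → u ∈I t
⋖-∈I u⋖v (inj₁ refl) = inj₂ [ u⋖v ]
⋖-∈I u⋖v (inj₂ v≺t)  = inj₂ (u⋖v ∷ v≺t)

split-off-one : ∀ {w : Vec ℕ (suc d)} (p : Fin d) → 1 ≤ lookup w (fsuc p) →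
  let w′ = split fzero (inject₁ p) (fsuc p) w in
  w ⋖ w′ × weight 1 w′ ≡ weight 1 w × weight 0 w ≡ suc (weight 0 w′)
split-off-one {w = w} p 1≤w[p+1] = w⋖w′ , sym same-weight , drop
  where
  open ≡-Reasoning
  i = fzero
  j = inject₁ p
  k = fsuc p
  w′ = split i j k w
  w≡w′+x = split-xvec i j k 1≤w[p+1]
  x≡0 : lbl k ℤ.- lbl i ℤ.- lbl j ≡ + 0
  x≡0 rewrite toℕ-inject₁ p = cancel (+ toℕ p)
    where
    cancel : ∀ t → + 2 ℤ.+ t ℤ.- + 1 ℤ.- (+ 1 ℤ.+ t) ≡ + 0
    cancel = solve-∀
  w⋖w′ : w ⋖ w′
  w⋖w′ = i , j , k , subst (+ suc _ ∣ℤ_) (sym x≡0) (_ ∣0) , w≡w′+x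
  same-weight : weight 1 w ≡ weight 1 w′
  same-weight = trans (ℤ.+-injective (trans (weight-step i j k w≡w′+x) (cong (λ x → + weight 1 w′ ℤ.+ x) x≡0)))
                      (ℕ.+-identityʳ _)
  drop : weight 0 w ≡ suc (weight 0 w′)
  drop = ℕ.+-cancelˡ-≡ (sum w) _ _ (begin
    sum w + weight 0 w          ≡⟨ weight-suc 0 w ⟨
    weight 1 w                  ≡⟨ same-weight ⟩
    weight 1 w′                 ≡⟨ weight-suc 0 w′ ⟩
    sum w′ + weight 0 w′        ≡⟨ cong (_+ weight 0 w′) (⋖-sum w⋖w′) ⟩
    suc (sum w) + weight 0 w′   ≡⟨ ℕ.+-suc (sum w) (weight 0 w′) ⟨
    sum w + suc (weight 0 w′)   ∎)

∈I-weight*e₀ : ∀ r (w : Vec ℕ (suc d)) → weight 0 w ≡ r → w ∈I map (weight 1 w *_) (e fzero)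
∈I-weight*e₀ {d} r (w₀ ∷ rest) _ with nonzero-or-zeros rest
... | inj₂ refl = inj₁ (sym (trans (map-*-e₀ {d} _) (cong (_∷ zeros d) (weight-∷-zeros {d} w₀))))
∈I-weight*e₀ r w@(_ ∷ _) weight₀≡r | inj₁ (p , 1≤w[p+1]) with split-off-one {w = w} p 1≤w[p+1] | r
... | w⋖w′ , same-weight , drop | zero   = contradiction (trans (sym drop) weight₀≡r) λ ()
... | w⋖w′ , same-weight , drop | suc r′ =
  ⋖-∈I w⋖w′ (subst (λ n → w′ ∈I map (n *_) (e fzero)) same-weight
    (∈I-weight*e₀ r′ w′ (ℕ.suc-injective (trans (sym drop) weight₀≡r))))
  where w′ = split fzero (inject₁ p) (fsuc p) w

partsOf : ℕ → Vec ℕ d → List ℕ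
partsOf s []       = []
partsOf s (c ∷ cs) = partsOf (suc s) cs ++ replicate c s

multiplicity : ℕ → List ℕ → ℕ
multiplicity s l = length (filter (_≟ s) l)

multiplicities : ∀ d → ℕ → List ℕ → Vec ℕ d
multiplicities zero    s l = []
multiplicities (suc d) s l = multiplicity s l ∷ multiplicities d (suc s) l

sumᴸ-replicate : ∀ c s → sumᴸ (replicate c s) ≡ s * c
sumᴸ-replicate zero    s = sym (ℕ.*-zeroʳ s)
sumᴸ-replicate (suc c) s = trans (cong (λ x → s + x) (sumᴸ-replicate c s)) (sym (ℕ.*-suc s c))

sumᴸ-partsOf : ∀ s (cs : Vec ℕ d) → sumᴸ (partsOf s cs) ≡ weight s cs
sumᴸ-partsOf s []       = refl
sumᴸ-partsOf s (c ∷ cs) = begin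
  sumᴸ (partsOf (suc s) cs ++ replicate c s)           ≡⟨ sum-++ (partsOf (suc s) cs) (replicate c s) ⟩
  sumᴸ (partsOf (suc s) cs) + sumᴸ (replicate c s)     ≡⟨ cong₂ _+_ (sumᴸ-partsOf (suc s) cs) (sumᴸ-replicate c s) ⟩
  weight (suc s) cs + s * c                            ≡⟨ ℕ.+-comm (weight (suc s) cs) (s * c) ⟩
  s * c + weight (suc s) cs                            ∎
  where open ≡-Reasoning

length-partsOf : ∀ s (cs : Vec ℕ d) → length (partsOf s cs) ≡ sum cs
length-partsOf s []       = refl
length-partsOf s (c ∷ cs) = begin
  length (partsOf (suc s) cs ++ replicate c s)          ≡⟨ length-++ (partsOf (suc s) cs) ⟩
  length (partsOf (suc s) cs) + length (replicate c s)  ≡⟨ cong₂ _+_ (length-partsOf (suc s) cs) (length-replicate c) ⟩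
  sum cs + c                                            ≡⟨ ℕ.+-comm (sum cs) c ⟩
  c + sum cs                                            ∎
  where open ≡-Reasoning

partsOf-≥ : ∀ s (cs : Vec ℕ d) → All (s ≤_) (partsOf s cs)
partsOf-≥ s []       = []
partsOf-≥ s (c ∷ cs) = All.++⁺ (All.map ℕ.<⇒≤ (partsOf-≥ (suc s) cs)) (All.replicate⁺ c ℕ.≤-refl)

partsOf-sorted : ∀ s (cs : Vec ℕ d) → AllPairs _≥_ (partsOf s cs)
partsOf-sorted s []       = []
partsOf-sorted s (c ∷ cs) = AllPairs.++⁺ (partsOf-sorted (suc s) cs) (replicate-sorted c)
  (All.map (λ s<x → All.replicate⁺ c (ℕ.<⇒≤ s<x)) (partsOf-≥ (suc s) cs))
  where
  replicate-sorted : ∀ c → AllPairs _≥_ (replicate c s)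
  replicate-sorted zero    = []
  replicate-sorted (suc c) = All.replicate⁺ c ℕ.≤-refl ∷ replicate-sorted c

multiplicity-++ : ∀ s xs ys → multiplicity s (xs ++ ys) ≡ multiplicity s xs + multiplicity s ys
multiplicity-++ s xs ys = trans (cong length (filter-++ (_≟ s) xs ys)) (length-++ (filter (_≟ s) xs))

multiplicity-replicate : ∀ c s → multiplicity s (replicate c s) ≡ c
multiplicity-replicate c s = trans (cong length (filter-all (_≟ s) (All.replicate⁺ c refl))) (length-replicate c)

multiplicity-absent : ∀ {s l} → All (λ x → x ≢ s) l → multiplicity s l ≡ 0
multiplicity-absent {s} none = cong length (filter-none (_≟ s) none)

multiplicities-++-below : ∀ d s xs {ys} → All (_< s) ys →
  multiplicities d s (xs ++ ys) ≡ multiplicities d s xs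
multiplicities-++-below zero    s xs ys<s = refl
multiplicities-++-below (suc d) s xs {ys} ys<s = cong₂ _∷_
  (begin
    multiplicity s (xs ++ ys)               ≡⟨ multiplicity-++ s xs ys ⟩
    multiplicity s xs + multiplicity s ys   ≡⟨ cong (λ x → multiplicity s xs + x) (multiplicity-absent (All.map ℕ.<⇒≢ ys<s)) ⟩
    multiplicity s xs + 0                   ≡⟨ ℕ.+-identityʳ _ ⟩
    multiplicity s xs                       ∎)
  (multiplicities-++-below d (suc s) xs (All.map ℕ.m≤n⇒m≤1+n ys<s))
  where open ≡-Reasoning

multiplicities-partsOf : ∀ s (cs : Vec ℕ d) → multiplicities d s (partsOf s cs) ≡ cs
multiplicities-partsOf s []           = refl
multiplicities-partsOf s (c ∷ cs) = cong₂ _∷_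
  (begin
    multiplicity s (partsOf (suc s) cs ++ replicate c s)
      ≡⟨ multiplicity-++ s (partsOf (suc s) cs) (replicate c s) ⟩
    multiplicity s (partsOf (suc s) cs) + multiplicity s (replicate c s)
      ≡⟨ cong₂ _+_ (multiplicity-absent (All.map ℕ.>⇒≢ (partsOf-≥ (suc s) cs))) (multiplicity-replicate c s) ⟩
    c ∎)
  (trans (multiplicities-++-below _ (suc s) (partsOf (suc s) cs) (All.replicate⁺ c ℕ.≤-refl))
         (multiplicities-partsOf (suc s) cs))
  where open ≡-Reasoning

sorted-split : ∀ s {l} → AllPairs _≥_ l → All (s ≤_) l →
  ∃₂ λ xs c → l ≡ xs ++ replicate c s × All (s <_) xs × AllPairs _≥_ xs
sorted-split s {[]}    []            []            = [] , 0 , refl , [] , []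
sorted-split s {x ∷ l} (x≥l ∷ l↓) (s≤x ∷ s≤l) with ℕ.m≤n⇒m<n∨m≡n s≤x
... | inj₂ refl = [] , suc (length l) , cong (s ∷_) (all-equal x≥l s≤l) , [] , []
  where
  all-equal : ∀ {l} → All (_≤ s) l → All (s ≤_) l → l ≡ replicate (length l) s
  all-equal []           []           = refl
  all-equal (x≤s ∷ ≤s)   (s≤x ∷ s≤)   = cong₂ _∷_ (ℕ.≤-antisym x≤s s≤x) (all-equal ≤s s≤)
... | inj₁ s<x with sorted-split s l↓ s≤l
...   | xs , c , refl , s<xs , xs↓ = x ∷ xs , c , refl , s<x ∷ s<xs , All.++⁻ˡ xs x≥l ∷ xs↓

partsOf-multiplicities : ∀ d s {l} → AllPairs _≥_ l → All (s ≤_) l → All (_< s + d) l →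
  partsOf s (multiplicities d s l) ≡ l
partsOf-multiplicities zero    s {[]}    _ _ _ = refl
partsOf-multiplicities zero    s {x ∷ l} _ (s≤x ∷ _) (x<s+0 ∷ _) =
  contradiction (ℕ.<-≤-trans x<s+0 (ℕ.≤-trans (ℕ.≤-reflexive (ℕ.+-identityʳ s)) s≤x)) (ℕ.<-irrefl refl)
partsOf-multiplicities (suc d) s l↓ s≤l l<s+d with sorted-split s l↓ s≤l
... | xs , c , refl , s<xs , xs↓ = cong₂ _++_ partsOf-above multiplicity-s
  where
  multiplicity-s : replicate (multiplicity s (xs ++ replicate c s)) s ≡ replicate c s
  multiplicity-s = cong (λ m → replicate m s) (begin
    multiplicity s (xs ++ replicate c s)               ≡⟨ multiplicity-++ s xs (replicate c s) ⟩
    multiplicity s xs + multiplicity s (replicate c s) ≡⟨ cong₂ _+_ (multiplicity-absent (All.map ℕ.>⇒≢ s<xs)) (multiplicity-replicate c s) ⟩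
    c                                                  ∎)
    where open ≡-Reasoning
  xs<s+1+d : All (_< suc s + d) xs
  xs<s+1+d = All.map (λ {x} → subst (x <_) (ℕ.+-suc s d)) (All.++⁻ˡ xs l<s+d)
  partsOf-above : partsOf (suc s) (multiplicities d (suc s) (xs ++ replicate c s)) ≡ xs
  partsOf-above = trans (cong (partsOf (suc s)) (multiplicities-++-below d (suc s) xs (All.replicate⁺ c ℕ.≤-refl)))
                        (partsOf-multiplicities d (suc s) xs↓ s<xs xs<s+1+d)

parts≤sum : ∀ l → All (_≤ sumᴸ l) l
parts≤sum []      = []
parts≤sum (x ∷ l) = ℕ.m≤m+n x (sumᴸ l) ∷ All.map (λ y≤Σl → ℕ.≤-trans y≤Σl (ℕ.m≤n+m (sumᴸ l) x)) (parts≤sum l)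

partsOf-isPartition : ∀ {m} (cs : Vec ℕ d) → weight 1 cs ≡ m → IsPartition m (partsOf 1 cs)
partsOf-isPartition cs weight≡m =
  partsOf-≥ 1 cs , AllPairs⇒Linked (partsOf-sorted 1 cs) , trans (sumᴸ-partsOf 1 cs) weight≡m

partsOf-multiplicities-partition : ∀ {m l} → IsPartition m l → m < suc d → partsOf 1 (multiplicities d 1 l) ≡ l
partsOf-multiplicities-partition {d} {l = l} (positive , l↓ , sum≡m) m<d =
  partsOf-multiplicities d 1 (Linked⇒AllPairs (λ x≥y y≥z → ℕ.≤-trans y≥z x≥y) l↓) positive
    (All.map (λ x≤Σl → ℕ.≤-<-trans x≤Σl (subst (_< suc d) (sym sum≡m) m<d)) (parts≤sum l))

+≼⇒≼∸ : ∀ {h a b d} → h + a ≼[ d ] b → a ≼[ d ] b ∸ h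
+≼⇒≼∸ {h} {a} {d = d} (q , b≡) =
  q , trans (cong (_∸ h) b≡) (trans (cong (_∸ h) (ℕ.+-assoc h a (d * q))) (ℕ.m+n∸m≡n h (a + d * q)))

weight-*e₀ : ∀ n → weight 1 (map (n *_) (e {suc d} fzero)) ≡ n
weight-*e₀ {d} n = trans (cong (weight 1) (map-*-e₀ {d} n)) (weight-∷-zeros {d} n)

∈I-slice⇒weight : ∀ {n h} {w : Vec ℕ (suc d)} → n ∸ h < suc d →
  w ∈I map (n *_) (e fzero) → sum w ≡ h → weight 1 (tail w) ≡ n ∸ h
∈I-slice⇒weight {d} {n} {h} {w₀ ∷ rest} n∸h<d w∈I refl = ≼-<⇒≡ (+≼⇒≼∸ h+r≼n) n∸h<d
  where
  h+r≼n : sum (w₀ ∷ rest) + weight 1 rest ≼[ suc d ] n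
  h+r≼n = subst₂ (λ a b → a ≼[ suc d ] b) (weight-suc 0 (w₀ ∷ rest)) (weight-*e₀ {d} n) (∈I⇒weight≼ w∈I)

weight⇒∈I-slice : ∀ {n h} {w : Vec ℕ (suc d)} → h ≤ n →
  sum w ≡ h → weight 1 (tail w) ≡ n ∸ h → w ∈I map (n *_) (e fzero)
weight⇒∈I-slice {n = n} {h} {w₀ ∷ rest} h≤n sum≡h weight≡ =
  subst (λ n → (w₀ ∷ rest) ∈I map (n *_) (e fzero)) weight≡n (∈I-weight*e₀ _ (w₀ ∷ rest) refl)
  where
  weight≡n : weight 1 (w₀ ∷ rest) ≡ n
  weight≡n = trans (weight-suc 0 (w₀ ∷ rest)) (trans (cong₂ _+_ sum≡h weight≡) (ℕ.m+[n∸m]≡n h≤n))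

sliceVector : ∀ d → ℕ → List ℕ → Vec ℕ (suc d)
sliceVector d h l = (h ∸ length l) ∷ multiplicities d 1 l

sliceVector-partsOf : ∀ {h} (w : Vec ℕ (suc d)) → sum w ≡ h → sliceVector d h (partsOf 1 (tail w)) ≡ w
sliceVector-partsOf (w₀ ∷ rest) refl = cong₂ _∷_
  (trans (cong (w₀ + sum rest ∸_) (length-partsOf 1 rest)) (ℕ.m+n∸n≡m w₀ (sum rest)))
  (multiplicities-partsOf 1 rest)

toPartition : ∀ {d n h} → n ∸ h < suc d → ISlice d n h → Partition (n ∸ h)
toPartition n∸h<d (w , w∈I , sum≡h) =
  partsOf 1 (tail w) , partsOf-isPartition (tail w) (∈I-slice⇒weight n∸h<d w∈I sum≡h)

fromPartition : ∀ {d n h} → h ≤ n → n ∸ h ≤ h → n ∸ h < suc d → Partition (n ∸ h) → ISlice d n h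
fromPartition {d} {n} {h} h≤n n∸h≤h n∸h<d (l , l-partition) =
  sliceVector d h l , weight⇒∈I-slice h≤n sum≡h weight≡ , sum≡h
  where
  cs = multiplicities d 1 l
  roundtrip : partsOf 1 cs ≡ l
  roundtrip = partsOf-multiplicities-partition l-partition n∸h<d
  weight≡ : weight 1 cs ≡ n ∸ h
  weight≡ = trans (sym (sumᴸ-partsOf 1 cs)) (trans (cong sumᴸ roundtrip) (proj₂ (proj₂ l-partition)))
  sum≡length : sum cs ≡ length l
  sum≡length = trans (sym (length-partsOf 1 cs)) (cong length roundtrip)
  length≤h : length l ≤ h
  length≤h = begin
    length l         ≡⟨ sum≡length ⟨
    sum cs           ≤⟨ ℕ.m≤m+n (sum cs) (weight 0 cs) ⟩
    sum cs + weight 0 cs ≡⟨ weight-suc 0 cs ⟨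
    weight 1 cs      ≡⟨ weight≡ ⟩
    n ∸ h            ≤⟨ n∸h≤h ⟩
    h                ∎
    where open ℕ.≤-Reasoning
  sum≡h : sum (sliceVector d h l) ≡ h
  sum≡h = trans (cong (λ x → h ∸ length l + x) sum≡length) (ℕ.m∸n+n≡m length≤h)

2[n∸h]<n⇒n∸h≤h : ∀ {n h} → 2 * (n ∸ h) < n → n ∸ h ≤ h
2[n∸h]<n⇒n∸h≤h {n} {h} 2m<n = ℕ.<⇒≤ (ℕ.+-cancelˡ-< (n ∸ h) (n ∸ h) h (begin-strict
  n ∸ h + (n ∸ h)       ≡⟨ cong (λ x → n ∸ h + x) (ℕ.+-identityʳ (n ∸ h)) ⟨
  2 * (n ∸ h)           <⟨ 2m<n ⟩
  n                     ≤⟨ ℕ.m≤n+m∸n n h ⟩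
  h + (n ∸ h)           ≡⟨ ℕ.+-comm h (n ∸ h) ⟩
  n ∸ h + h             ∎))
  where open ℕ.≤-Reasoning

proposition7p5 : (d' n h : ℕ) → h ≤ n → n ∸ h < suc d' → 2 * (n ∸ h) < n →
    Inverse (ISliceSetoid d' n h) (PartitionSetoid (n ∸ h))
proposition7p5 d' n h h≤n n∸h<d 2[n∸h]<n = record
  { to        = toPartition n∸h<d
  ; from      = fromPartition h≤n (2[n∸h]<n⇒n∸h≤h 2[n∸h]<n) n∸h<d
  ; to-cong   = cong (partsOf 1 ∘ tail)
  ; from-cong = cong (sliceVector d' h)
  ; inverse   = (λ {(l , l-partition)} w≡ →
                   trans (cong (partsOf 1 ∘ tail) w≡) (partsOf-multiplicities-partition l-partition n∸h<d))
              , (λ {(w , _ , sum≡h)} l≡ → trans (cong (sliceVector d' h) l≡) (sliceVector-partsOf w sum≡h))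
  }
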